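{- Let $B$ be a simple graph and let $0\leq s<t$ be integers. Let $B_s$ (resp. $B_t$) be the graph with underlying simple graph $B$ in which every edge has multiplicity exactly $s+1$ (resp. $t+1$). If $\operatorname{cfan}(B_s)\leq s$, then $\operatorname{cfan}(B_t)\leq t$.
   Context: A graph may have parallel edges but no loops. For a graph $J$, $\mu_J(x,y)$ is the number of edges of $J$ joining $x$ and $y$; $d_J(v)$ is the degree of $v$ counting parallel edges; $N_J(x)$ is the neighbourhood of $x$. A subgraph may contain only some of the parallel copies of an edge. For a graph $H$, a subgraph $K\subseteq H$ and an ordered pair $(x,y)$ with $xy\in E(K)$, $\operatorname{cdeg}_{H,K}(x,y)$ is the smallest nonnegative integer $l$ such that for all $Z\subseteq N_K(x)$ with $y\in Z$, $\sum_{z\in Z}(d_K(z)-d_H(z)+\mu_K(x,z)-l)\leq 1$; $\operatorname{cfan}(H)=\max_{K\subseteq H,\,E(K)\neq\emptyset}\min\{\operatorname{cdeg}_{H,K}(x,y): xy\in E(K)\}$, with $\operatorname{cfan}(H)=0$ if $H$ is edgeless. -}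

module Defs where

open import Data.Nat using (ℕ; zero; suc; _≤_; _<_)
import Data.Nat
open import Data.Integer using (ℤ; +_; _-_; _+_)
import Data.Integer as ℤ
open import Data.Fin using (Fin)
open import Data.List using (List; map; allFin)
import Data.List as L
open import Data.Bool using (Bool; true; false; if_then_else_)
open import Data.Vec using (lookup)
open import Data.Fin.Subset using (Subset; _∈_)
open import Data.Product using (Σ; ∃; ∃-syntax; _×_)
open import Relation.Binary.PropositionalEquality using (_≡_)
open import Relation.Nullary using (¬_)

-- A loopless multigraph on vertex set Fin n, given by its edge multiplicity
-- function μ (μ x y = number of parallel edges joining x and y).
record Graph (n : ℕ) : Set where
  field
    μ        : Fin n → Fin n → ℕ
    μ-sym    : ∀ x y → μ x y ≡ μ y x
    loopless : ∀ x → μ x x ≡ 0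
open Graph public

record SimpleGraph (n : ℕ) : Set where
  field
    adj       : Fin n → Fin n → Bool
    adj-sym   : ∀ x y → adj x y ≡ adj y x
    adj-irrefl : ∀ x → adj x x ≡ false
open SimpleGraph public

ΣV : ∀ {n} → (Fin n → ℕ) → ℕ
ΣV {n} f = L.foldr Data.Nat._+_ 0 (map f (allFin n))

ΣVℤ : ∀ {n} → (Fin n → ℤ) → ℤ
ΣVℤ {n} f = L.foldr _+_ (+ 0) (map f (allFin n))

deg : ∀ {n} → Graph n → Fin n → ℕ
deg G v = ΣV (λ u → μ G v u)

-- K is a subgraph of H (a subgraph may keep only some parallel copies).
-- Vertices of K outside its edges play no role in any quantity below.
_⊆G_ : ∀ {n} → Graph n → Graph n → Set
K ⊆G H = ∀ x y → μ K x y ≤ μ H x y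

IsEdge : ∀ {n} → Graph n → Fin n → Fin n → Set
IsEdge K x y = 0 < μ K x y

HasEdge : ∀ {n} → Graph n → Set
HasEdge K = ∃[ x ] ∃[ y ] IsEdge K x y

CdegCond : ∀ {n} → Graph n → Graph n → Fin n → Fin n → ℕ → Set
CdegCond {n} H K x y l =
  (Z : Subset n) → (∀ z → z ∈ Z → 0 < μ K x z) → y ∈ Z →
  ΣVℤ (λ z → if lookup Z z
               then (+ deg K z) - (+ deg H z) + (+ μ K x z) - (+ l)
               else + 0)
    ℤ.≤ + 1

IsCdeg : ∀ {n} → Graph n → Graph n → Fin n → Fin n → ℕ → Set
IsCdeg H K x y l = CdegCond H K x y l × (∀ l' → l' < l → ¬ CdegCond H K x y l')

-- cfan(H) ≤ t, unfolded: cfan(H) is the max over subgraphs K with E(K) ≠ ∅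
-- of min_{xy ∈ E(K)} cdeg_{H,K}(x,y) (and 0 if H is edgeless); so
-- cfan(H) ≤ t iff every such K has an edge xy with cdeg_{H,K}(x,y) ≤ t.
CfanLe : ∀ {n} → Graph n → ℕ → Set
CfanLe {n} H t =
  (K : Graph n) → K ⊆G H → HasEdge K →
  ∃[ x ] ∃[ y ] (IsEdge K x y × ∃[ l ] (IsCdeg H K x y l × l ≤ t))

blowup : ∀ {n} → SimpleGraph n → ℕ → Graph n
blowup {n} B s = record
  { μ        = m
  ; μ-sym    = sym'
  ; loopless = loop'
  }
  where
  m : Fin n → Fin n → ℕ
  m x y = if adj B x y then suc s else 0
  sym' : ∀ x y → m x y ≡ m y x
  sym' x y rewrite adj-sym B x y = Relation.Binary.PropositionalEquality.refl
  loop' : ∀ x → m x x ≡ 0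
  loop' x rewrite adj-irrefl B x = Relation.Binary.PropositionalEquality.refl

-- Write t = s + d and, for K ⊆ B_t, let K′ ⊆ B_s be K with every multiplicity
-- lowered by d (truncated at 0). If K′ has no edge, every multiplicity of K is
-- at most d ≤ t, so each summand of the cdeg condition at level t is nonpositive
-- and any edge of K will do. Otherwise cfan(B_s) ≤ s yields an edge xy of K′ and
-- l ≤ s satisfying the condition for (B_s, K′). Given Z ∋ y, the summands for
-- (B_t, K) at level t over Z ∩ N_K′(x) are bounded by those for (B_s, K′) at
-- level l, because d_K − d_{B_t} ≤ d_K′ − d_{B_s}; the summands dropped from Z
-- have μ_K(x,z) ≤ d and are nonpositive. The condition being decidable, the
-- least admissible value, i.e. cdeg, is then at most t.
module Submission where

open import Defs
open import Algebra.Properties.CommutativeSemigroup as CommSemigroup using ()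
open import Data.Bool using (true; false; if_then_else_; _∧_)
open import Data.Fin using (Fin; toℕ; fromℕ; fromℕ<)
open import Data.Fin.Properties
  using (any?; all?; ¬∀⟶∃¬-smallest; toℕ-fromℕ; toℕ-fromℕ<; toℕ-inject; toℕ≤pred[n])
open import Data.Fin.Subset using (Subset; _∈_; _∉_; _∩_)
open import Data.Fin.Subset.Properties using (_∈?_; anySubset?; x∈p∩q⁺; x∈p∩q⁻)
open import Data.Integer as ℤ using (ℤ; +_; 0ℤ; _⊖_; +≤+)
import Data.Integer.Properties as ℤₚ
open import Data.Integer.Tactic.RingSolver using (solve-∀)
open import Data.Nat.Tactic.RingSolver renaming (solve-∀ to solve-∀ℕ)
open import Data.List using ([]; _∷_; map; foldr; allFin)
open import Data.List.Properties using (foldr-preservesᵇ)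
open import Data.List.Relation.Binary.Pointwise as Pointwise using (Pointwise)
import Data.List.Relation.Unary.All.Properties as All
open import Data.Nat using (ℕ; suc; _+_; _∸_; _≤_; _<_; z≤n; _<?_)
import Data.Nat.Properties as ℕₚ
open import Data.Product using (∃-syntax; _×_; _,_; proj₂)
open import Data.Vec using (lookup; tabulate)
open import Data.Vec.Properties using (lookup-zipWith; lookup∘tabulate; lookup⇒[]=; []=⇒lookup)
open import Function using (_∘_)
open import Relation.Binary.PropositionalEquality
open import Relation.Nullary using (Dec; yes; no; ¬_; does; ¬?; contradiction)
open import Relation.Nullary.Decidable using (_→-dec_; decidable-stable; dec-true)
open import Relation.Unary using (Decidable)

private
  variable
    n : ℕ

pointwise-allFin : {A B : Set} {R : A → B → Set} {f : Fin n → A} {g : Fin n → B} →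
                   (∀ z → R (f z) (g z)) → Pointwise R (map f (allFin n)) (map g (allFin n))
pointwise-allFin {R = R} {f} {g} fRg =
  Pointwise.map⁺ {R = R} f g (Pointwise.tabulate⁺ {R = λ a b → R (f a) (g b)} fRg)

ΣV-mono : {f g : Fin n → ℕ} → (∀ z → f z ≤ g z) → ΣV f ≤ ΣV g
ΣV-mono f≤g =
  Pointwise.foldr⁺ {R = _≤_} ℕₚ.+-mono-≤ ℕₚ.≤-refl (pointwise-allFin f≤g)

ΣVℤ-mono : {f g : Fin n → ℤ} → (∀ z → f z ℤ.≤ g z) → ΣVℤ f ℤ.≤ ΣVℤ g
ΣVℤ-mono f≤g =
  Pointwise.foldr⁺ {R = ℤ._≤_} ℤₚ.+-mono-≤ ℤₚ.≤-refl (pointwise-allFin f≤g)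

ΣVℤ-nonpos : {f : Fin n → ℤ} → (∀ z → f z ℤ.≤ 0ℤ) → ΣVℤ f ℤ.≤ 0ℤ
ΣVℤ-nonpos f≤0 =
  foldr-preservesᵇ {P = ℤ._≤ 0ℤ} ℤₚ.+-mono-≤ ℤₚ.≤-refl (All.map⁺ (All.tabulate⁺ f≤0))

ΣV-distrib-+ : (f g : Fin n → ℕ) → ΣV (λ z → f z + g z) ≡ ΣV f + ΣV g
ΣV-distrib-+ {n} f g = go (allFin n)
  where
  open CommSemigroup ℕₚ.+-commutativeSemigroup using (interchange)
  go : ∀ zs → foldr _+_ 0 (map (λ z → f z + g z) zs)
            ≡ foldr _+_ 0 (map f zs) + foldr _+_ 0 (map g zs)
  go []       = refl
  go (z ∷ zs) = trans (cong (_+_ (f z + g z)) (go zs)) (interchange (f z) (g z) _ _)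

ΣV-+-mono : {f g f′ g′ : Fin n → ℕ} → (∀ z → f z + g z ≤ f′ z + g′ z) →
            ΣV f + ΣV g ≤ ΣV f′ + ΣV g′
ΣV-+-mono {f = f} {g} {f′} {g′} le =
  subst₂ _≤_ (ΣV-distrib-+ f g) (ΣV-distrib-+ f′ g′) (ΣV-mono le)

ΣSub : Subset n → (Fin n → ℤ) → ℤ
ΣSub Z f = ΣVℤ (λ z → if lookup Z z then f z else 0ℤ)

ΣSub-nonpos : (Z : Subset n) {f : Fin n → ℤ} → (∀ z → z ∈ Z → f z ℤ.≤ 0ℤ) →
              ΣSub Z f ℤ.≤ 0ℤ
ΣSub-nonpos Z {f} f≤0 = ΣVℤ-nonpos term≤0
  where
  term≤0 : ∀ z → (if lookup Z z then f z else 0ℤ) ℤ.≤ 0ℤ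
  term≤0 z with lookup Z z in Zz
  ... | true  = f≤0 z (lookup⇒[]= z Z Zz)
  ... | false = ℤₚ.≤-refl

ΣSub-∩-mono : (Z W : Subset n) {f g : Fin n → ℤ} →
              (∀ z → z ∈ Z → z ∈ W → f z ℤ.≤ g z) →
              (∀ z → z ∈ Z → z ∉ W → f z ℤ.≤ 0ℤ) →
              ΣSub Z f ℤ.≤ ΣSub (Z ∩ W) g
ΣSub-∩-mono Z W {f} {g} f≤g f≤0 = ΣVℤ-mono term≤
  where
  term≤ : ∀ z → (if lookup Z z then f z else 0ℤ)
              ℤ.≤ (if lookup (Z ∩ W) z then g z else 0ℤ)
  term≤ z rewrite lookup-zipWith _∧_ z Z W with lookup Z z in Zz | lookup W z in Wz
  ... | false | _     = ℤₚ.≤-refl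
  ... | true  | true  = f≤g z (lookup⇒[]= z Z Zz) (lookup⇒[]= z W Wz)
  ... | true  | false = f≤0 z (lookup⇒[]= z Z Zz)
                          (λ z∈W → contradiction (trans (sym ([]=⇒lookup z∈W)) Wz) λ ())

m≤n⇒m⊖n≤0 : ∀ {m n} → m ≤ n → m ⊖ n ℤ.≤ 0ℤ
m≤n⇒m⊖n≤0 {m} {n} m≤n = subst (m ⊖ n ℤ.≤_) (ℤₚ.n⊖n≡0 n) (ℤₚ.⊖-monoˡ-≤ n m≤n)

m+p≤o+n⇒m⊖n≤o⊖p : ∀ {m n o p} → m + p ≤ o + n → m ⊖ n ℤ.≤ o ⊖ p
m+p≤o+n⇒m⊖n≤o⊖p {m} {n} {o} {p} le = begin
  m ⊖ n             ≡⟨ sym (ℤₚ.+-cancelˡ-⊖ p m n) ⟩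
  (p + m) ⊖ (p + n) ≤⟨ ℤₚ.⊖-monoˡ-≤ (p + n) (subst₂ _≤_ (ℕₚ.+-comm m p) (ℕₚ.+-comm o n) le) ⟩
  (n + o) ⊖ (p + n) ≡⟨ cong ((n + o) ⊖_) (ℕₚ.+-comm p n) ⟩
  (n + o) ⊖ (n + p) ≡⟨ ℤₚ.+-cancelˡ-⊖ n o p ⟩
  o ⊖ p             ∎
  where open ℤₚ.≤-Reasoning

[+a-+b]+[+c-+d]≡[a+c]⊖[b+d] : ∀ a b c d →
  (+ a) ℤ.- (+ b) ℤ.+ (+ c) ℤ.- (+ d) ≡ (a + c) ⊖ (b + d)
[+a-+b]+[+c-+d]≡[a+c]⊖[b+d] a b c d = begin
  (+ a) ℤ.- (+ b) ℤ.+ (+ c) ℤ.- (+ d)   ≡⟨ regroup (+ a) (+ b) (+ c) (+ d) ⟩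
  (+ a ℤ.+ + c) ℤ.- (+ b ℤ.+ + d)       ≡⟨ sym (cong₂ ℤ._-_ (ℤₚ.pos-+ a c) (ℤₚ.pos-+ b d)) ⟩
  + (a + c) ℤ.- + (b + d)               ≡⟨ ℤₚ.[+m]-[+n]≡m⊖n (a + c) (b + d) ⟩
  (a + c) ⊖ (b + d)                     ∎
  where
  open ≡-Reasoning
  regroup : ∀ (a b c d : ℤ) → a ℤ.- b ℤ.+ c ℤ.- d ≡ (a ℤ.+ c) ℤ.- (b ℤ.+ d)
  regroup = solve-∀

m+o≤m∸n+[o+n] : ∀ m n o → m + o ≤ (m ∸ n) + (o + n)
m+o≤m∸n+[o+n] m n o = begin
  m + o             ≤⟨ ℕₚ.+-monoˡ-≤ o (ℕₚ.m≤n+m∸n m n) ⟩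
  n + (m ∸ n) + o   ≡⟨ shuffle n (m ∸ n) o ⟩
  (m ∸ n) + (o + n) ∎
  where
  open ℕₚ.≤-Reasoning
  shuffle : ∀ a b c → a + b + c ≡ b + (c + a)
  shuffle = solve-∀ℕ

least-≤ : {P : ℕ → Set} → Decidable P → ∀ {m} → P m →
          ∃[ l ] ((P l × (∀ l′ → l′ < l → ¬ P l′)) × l ≤ m)
least-≤ {P} P? {m} Pm with ¬∀⟶∃¬-smallest (suc m) (¬_ ∘ P ∘ toℕ) (¬? ∘ P? ∘ toℕ)
                              (λ ∀¬P → ∀¬P (fromℕ m) (subst P (sym (toℕ-fromℕ m)) Pm))
... | i , ¬¬Pi , below =
  toℕ i , (decidable-stable (P? (toℕ i)) ¬¬Pi , below-fails) , toℕ≤pred[n] i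
  where
  below-fails : ∀ l′ → l′ < toℕ i → ¬ P l′
  below-fails l′ l′<i = subst (¬_ ∘ P) (trans (toℕ-inject j) (toℕ-fromℕ< l′<i)) (below j)
    where j = fromℕ< l′<i

∀Subset? : {P : Subset n → Set} → Decidable P → Dec (∀ Z → P Z)
∀Subset? P? with anySubset? (¬? ∘ P?)
... | yes (Z , ¬PZ) = no λ ∀P → ¬PZ (∀P Z)
... | no ¬∃¬P       = yes λ Z → decidable-stable (P? Z) (λ ¬PZ → ¬∃¬P (Z , ¬PZ))

hasEdge? : (G : Graph n) → Dec (HasEdge G)
hasEdge? G = any? λ x → any? λ y → 0 <? μ G x y

CdegCond? : (H K : Graph n) (x y : Fin n) (l : ℕ) → Dec (CdegCond H K x y l)
CdegCond? H K x y l = ∀Subset? λ Z →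
  all? (λ z → z ∈? Z →-dec 0 <? μ K x z) →-dec (y ∈? Z →-dec (_ ℤₚ.≤? + 1))

N : Graph n → Fin n → Subset n
N G x = tabulate (λ z → does (0 <? μ G x z))

lookup-N : (G : Graph n) (x z : Fin n) → lookup (N G x) z ≡ does (0 <? μ G x z)
lookup-N G x = lookup∘tabulate (λ z → does (0 <? μ G x z))

∈N⇒IsEdge : {G : Graph n} {x z : Fin n} → z ∈ N G x → IsEdge G x z
∈N⇒IsEdge {G = G} {x} {z} z∈N =
  yes-witness (0 <? μ G x z) (trans (sym (lookup-N G x z)) ([]=⇒lookup z∈N))
  where
  yes-witness : (e? : Dec (IsEdge G x z)) → does e? ≡ true → IsEdge G x z
  yes-witness (yes xz∈G) _ = xz∈G
  yes-witness (no _)     ()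

IsEdge⇒∈N : {G : Graph n} {x z : Fin n} → IsEdge G x z → z ∈ N G x
IsEdge⇒∈N {G = G} {x} {z} xz∈G =
  lookup⇒[]= z (N G x) (trans (lookup-N G x z) (dec-true (0 <? μ G x z) xz∈G))

deg-mono : {H K : Graph n} → K ⊆G H → ∀ z → deg K z ≤ deg H z
deg-mono K⊆H z = ΣV-mono (K⊆H z)

thin : Graph n → ℕ → Graph n
thin K d = record
  { μ        = λ x y → μ K x y ∸ d
  ; μ-sym    = λ x y → cong (_∸ d) (μ-sym K x y)
  ; loopless = λ x → trans (cong (_∸ d) (loopless K x)) (ℕₚ.0∸n≡0 d)
  }

¬IsEdge-thin⇒μ≤ : ∀ {K : Graph n} {d x z} → ¬ IsEdge (thin K d) x z → μ K x z ≤ d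
¬IsEdge-thin⇒μ≤ xz∉K′ = ℕₚ.m∸n≡0⇒m≤n (ℕₚ.n≤0⇒n≡0 (ℕₚ.≮⇒≥ xz∉K′))

-- CdegCond H K x y l unfolds to
-- ∀ Z → (∀ z → z ∈ Z → IsEdge K x z) → y ∈ Z → ΣSub Z (cdegTerm H K x l) ℤ.≤ + 1.
cdegTerm : Graph n → Graph n → Fin n → ℕ → Fin n → ℤ
cdegTerm H K x l z = (+ deg K z) ℤ.- (+ deg H z) ℤ.+ (+ μ K x z) ℤ.- (+ l)

cdegTerm-nonpos : ∀ {H K : Graph n} {x l} → K ⊆G H →
                  ∀ z → μ K x z ≤ l → cdegTerm H K x l z ℤ.≤ 0ℤ
cdegTerm-nonpos {H = H} {K} {x} {l} K⊆H z μ≤l =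
  subst (ℤ._≤ 0ℤ) (sym ([+a-+b]+[+c-+d]≡[a+c]⊖[b+d] (deg K z) (deg H z) (μ K x z) l))
    (m≤n⇒m⊖n≤0 (ℕₚ.+-mono-≤ (deg-mono {H = H} {K} K⊆H z) μ≤l))

CdegCond-light : ∀ {H K : Graph n} {x y l} → K ⊆G H → (∀ z → μ K x z ≤ l) → CdegCond H K x y l
CdegCond-light {H = H} {K} {x} K⊆H light Z _ _ =
  ℤₚ.≤-trans (ΣSub-nonpos Z (λ z _ → cdegTerm-nonpos {H = H} {K} {x} K⊆H z (light z)))
             (+≤+ z≤n)

CfanLe-from-CdegCond : ∀ {H : Graph n} {t} →
  (∀ K → K ⊆G H → HasEdge K → ∃[ x ] ∃[ y ] (IsEdge K x y × CdegCond H K x y t)) →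
  CfanLe H t
CfanLe-from-CdegCond {H = H} edge K K⊆H K-edge with edge K K⊆H K-edge
... | x , y , xy∈K , cond with least-≤ (CdegCond? H K x y) cond
...   | l , isCdeg , l≤t = x , y , xy∈K , l , isCdeg , l≤t

module _ (B : SimpleGraph n) (s d : ℕ) where

  -- μ (blowup B m) x y reduces to  if adj B x y then suc m else 0.
  private
    Hₛ Hₜ : Graph n
    Hₛ = blowup B s
    Hₜ = blowup B (s + d)

    μ-thin-⊆ : ∀ b k → k ≤ (if b then suc (s + d) else 0) → k ∸ d ≤ (if b then suc s else 0)
    μ-thin-⊆ true  k k≤ = subst (k ∸ d ≤_) (ℕₚ.m+n∸n≡m (suc s) d) (ℕₚ.∸-monoˡ-≤ d k≤)
    μ-thin-⊆ false _ z≤n = ℕₚ.m∸n≤m 0 d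

    μ-thin-+ : ∀ b k → k ≤ (if b then suc (s + d) else 0) →
               k + (if b then suc s else 0) ≤ (k ∸ d) + (if b then suc (s + d) else 0)
    μ-thin-+ true  k _   = m+o≤m∸n+[o+n] k d (suc s)
    μ-thin-+ false _ z≤n = z≤n

  thin-⊆ : {K : Graph n} → K ⊆G Hₜ → thin K d ⊆G Hₛ
  thin-⊆ {K} K⊆ x y = μ-thin-⊆ (adj B x y) (μ K x y) (K⊆ x y)

  deg-thin : {K : Graph n} → K ⊆G Hₜ → ∀ z → deg K z + deg Hₛ z ≤ deg (thin K d) z + deg Hₜ z
  deg-thin {K} K⊆ z = ΣV-+-mono (λ v → μ-thin-+ (adj B z v) (μ K z v) (K⊆ z v))

  cdegTerm-thin : ∀ {K : Graph n} {l} → K ⊆G Hₜ → l ≤ s → ∀ x z →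
                  cdegTerm Hₜ K x (s + d) z ℤ.≤ cdegTerm Hₛ (thin K d) x l z
  cdegTerm-thin {K} {l} K⊆ l≤s x z = begin
    cdegTerm Hₜ K x (s + d) z
      ≡⟨ [+a-+b]+[+c-+d]≡[a+c]⊖[b+d] (deg K z) (deg Hₜ z) c (s + d) ⟩
    (deg K z + c) ⊖ (deg Hₜ z + (s + d))
      ≤⟨ m+p≤o+n⇒m⊖n≤o⊖p {deg K z + c} {deg Hₜ z + (s + d)} arith ⟩
    (deg K′ z + (c ∸ d)) ⊖ (deg Hₛ z + l)
      ≡⟨ sym ([+a-+b]+[+c-+d]≡[a+c]⊖[b+d] (deg K′ z) (deg Hₛ z) (c ∸ d) l) ⟩
    cdegTerm Hₛ K′ x l z ∎
    where
    open ℤₚ.≤-Reasoning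
    open CommSemigroup ℕₚ.+-commutativeSemigroup using (interchange)
    K′ : Graph n
    K′ = thin K d
    c : ℕ
    c = μ K x z
    c+l≤ : c + l ≤ (c ∸ d) + (s + d)
    c+l≤ = ℕₚ.≤-trans (m+o≤m∸n+[o+n] c d l) (ℕₚ.+-monoʳ-≤ (c ∸ d) (ℕₚ.+-monoˡ-≤ d l≤s))
    arith : deg K z + c + (deg Hₛ z + l) ≤ deg K′ z + (c ∸ d) + (deg Hₜ z + (s + d))
    arith = subst₂ _≤_ (interchange (deg K z) (deg Hₛ z) c l)
                       (interchange (deg K′ z) (deg Hₜ z) (c ∸ d) (s + d))
                       (ℕₚ.+-mono-≤ (deg-thin {K} K⊆ z) c+l≤)

  CdegCond-thin : ∀ {K : Graph n} {x y l} → K ⊆G Hₜ → l ≤ s → d < μ K x y →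
                  CdegCond Hₛ (thin K d) x y l → CdegCond Hₜ K x y (s + d)
  CdegCond-thin {K} {x} {y} {l} K⊆ l≤s heavy cond Z _ y∈Z = ℤₚ.≤-trans
    (ΣSub-∩-mono Z (N K′ x) (λ z _ _ → cdegTerm-thin {K} K⊆ l≤s x z) light)
    (cond (Z ∩ N K′ x) (λ z z∈ → ∈N⇒IsEdge {G = K′} (proj₂ (x∈p∩q⁻ Z (N K′ x) z∈)))
          (x∈p∩q⁺ (y∈Z , IsEdge⇒∈N {G = K′} (ℕₚ.m<n⇒0<n∸m heavy))))
    where
    K′ : Graph n
    K′ = thin K d
    light : ∀ z → z ∈ Z → z ∉ N K′ x → cdegTerm Hₜ K x (s + d) z ℤ.≤ 0ℤ
    light z _ z∉N = cdegTerm-nonpos {H = Hₜ} {K} K⊆ z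
      (ℕₚ.≤-trans (¬IsEdge-thin⇒μ≤ {K = K} (z∉N ∘ IsEdge⇒∈N {G = K′})) (ℕₚ.m≤n+m d s))

  edge-with-CdegCond : CfanLe Hₛ s → ∀ K → K ⊆G Hₜ → HasEdge K →
                       ∃[ x ] ∃[ y ] (IsEdge K x y × CdegCond Hₜ K x y (s + d))
  edge-with-CdegCond cfan≤s K K⊆ (x , y , xy∈K) with hasEdge? (thin K d)
  ... | no K′-edgeless = x , y , xy∈K , CdegCond-light {H = Hₜ} {K} K⊆ light
    where
    light : ∀ z → μ K x z ≤ s + d
    light z = ℕₚ.≤-trans (¬IsEdge-thin⇒μ≤ {K = K} λ xz∈K′ → K′-edgeless (x , z , xz∈K′))
                         (ℕₚ.m≤n+m d s)
  ... | yes K′-edge with cfan≤s (thin K d) (thin-⊆ {K} K⊆) K′-edge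
  ...   | x′ , y′ , xy∈K′ , l , (cond , _) , l≤s =
    x′ , y′ , ℕₚ.<-≤-trans xy∈K′ (ℕₚ.m∸n≤m _ d) ,
    CdegCond-thin {K} K⊆ l≤s (ℕₚ.m∸n≢0⇒n<m (ℕₚ.n>0⇒n≢0 xy∈K′)) cond

  CfanLe-blowup-+ : CfanLe Hₛ s → CfanLe Hₜ (s + d)
  CfanLe-blowup-+ cfan≤s = CfanLe-from-CdegCond {H = Hₜ} (edge-with-CdegCond cfan≤s)

lemma3p5 : ∀ {n} (B : SimpleGraph n) (s t : ℕ) → s < t →
    CfanLe (blowup B s) s → CfanLe (blowup B t) t
lemma3p5 B s t s<t cfan≤s = subst (λ t → CfanLe (blowup B t) t)
  (ℕₚ.m+[n∸m]≡n (ℕₚ.<⇒≤ s<t)) (CfanLe-blowup-+ B s (t ∸ s) cfan≤s)
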